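{- Let $m\ge 3$ be odd. Then the digraph ${\cal R}^{*}_{m}$ has exactly $$|V({\cal R}^{*}_{m})| = \binom{m+1}{(m-1)/2}$$ vertices, and the digraph ${\cal R}^{**}_{m}$ has exactly $$|V({\cal R}^{**}_{m})| = \frac{1}{2}\left[\binom{m+1}{(m-1)/2} + \binom{(m+1)/2}{\lfloor (m+1)/4\rfloor}\right]$$ vertices.
   Context: Consider the grid graph $P_m\times P_n$ with vertices arranged in $m$ rows (numbered top to bottom) and $n$ columns. In a 2-factor (spanning union of cycles) every vertex has exactly two incident edges among the directions up, down, left, right; these six possibilities are coded by letters: $a=\{\text{right},\text{down}\}$, $b=\{\text{up},\text{down}\}$, $c=\{\text{right},\text{up}\}$, $d=\{\text{left},\text{down}\}$, $e=\{\text{left},\text{right}\}$, $f=\{\text{left},\text{up}\}$. An alpha-word of length $m$ is a word $\alpha_1\alpha_2\cdots\alpha_m$ over $\{a,b,c,d,e,f\}$ such that $\alpha_1\in\{a,d,e\}$, $\alpha_m\in\{c,e,f\}$, and for each $1\le i\le m-1$, $\alpha_i$ contains "down" if and only if $\alpha_{i+1}$ contains "up". The digraph ${\cal D}_m$ has the alpha-words of length $m$ as vertices, with an arc $v\to u$ iff for every $i$, $v_i$ contains "right" if and only if $u_i$ contains "left". The outlet word of an alpha-word $\alpha$ is the binary word $o(\alpha)=o_1\cdots o_m$ with $o_j=1$ if $\alpha_j\in\{a,c,e\}$ and $o_j=0$ if $\alpha_j\in\{b,d,f\}$. The digraph ${\cal D}^*_m$ has as vertices all binary words $o(\alpha)$,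 $\alpha\in V({\cal D}_m)$, with an arc $x\to y$ iff there exist $v,u\in V({\cal D}_m)$ with $o(v)=x$, $o(u)=y$ and $v\to u$ an arc of ${\cal D}_m$ (no multiple arcs). ${\cal R}^*_m$ denotes the connected component of ${\cal D}^*_m$ containing the word $0^m$. For a binary word $x=b_1\cdots b_m$ let $\overline{x}=b_m\cdots b_1$ be its reversal (it is known that $x\in V({\cal R}^*_m)$ implies $\overline{x}\in V({\cal R}^*_m)$). The digraph ${\cal R}^{**}_m$ is obtained from ${\cal R}^*_m$ by identifying each vertex $x$ with $\overline{x}$; thus its vertices are the sets $\{x,\overline{x}\}$ with $x\in V({\cal R}^*_m)$. -}

module Defs where

open import Data.Bool using (Bool; true; false)
open import Data.Nat using (ℕ; zero; suc)
open import Data.Fin using (Fin)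
open import Data.Vec using (Vec; []; _∷_; lookup; replicate; reverse)
open import Data.List using (List; length)
open import Data.List.Membership.Propositional using (_∈_)
open import Data.List.Relation.Unary.All using (All)
open import Data.List.Relation.Unary.Any using (Any)
open import Data.List.Relation.Unary.AllPairs using (AllPairs)
open import Data.List.Relation.Unary.Unique.Propositional using (Unique)
open import Data.Product using (Σ; _×_; ∃)
open import Data.Sum using (_⊎_)
open import Data.Unit using (⊤)
open import Data.Empty using (⊥)
open import Relation.Nullary using (¬_)
open import Relation.Binary.PropositionalEquality using (_≡_)
open import Function.Bundles using (_⇔_)

-- The six local configurations of a vertex in a 2-factor of a grid graph.
-- a = {right,down}, b = {up,down}, c = {right,up},
-- d = {left,down},  e = {left,right}, f = {left,up}
data Letter : Set where
  a b c d e f : Letter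

hasUp hasDown hasLeft hasRight : Letter → Bool
hasUp a = false
hasUp b = true
hasUp c = true
hasUp d = false
hasUp e = false
hasUp f = true
hasDown a = true
hasDown b = true
hasDown c = false
hasDown d = true
hasDown e = false
hasDown f = false
hasLeft a = false
hasLeft b = false
hasLeft c = false
hasLeft d = true
hasLeft e = true
hasLeft f = true
hasRight a = true
hasRight b = false
hasRight c = true
hasRight d = false
hasRight e = true
hasRight f = false

FirstOK : Letter → Set
FirstOK a = ⊤
FirstOK d = ⊤
FirstOK e = ⊤
FirstOK _ = ⊥

LastOK : Letter → Set
LastOK c = ⊤
LastOK e = ⊤
LastOK f = ⊤
LastOK _ = ⊥

StartOK : ∀ {n} → Vec Letter n → Set
StartOK [] = ⊤
StartOK (x ∷ _) = FirstOK x

EndOK : ∀ {n} → Vec Letter n → Set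
EndOK [] = ⊤
EndOK (x ∷ []) = LastOK x
EndOK (x ∷ y ∷ xs) = EndOK (y ∷ xs)

Consec : ∀ {n} → Vec Letter n → Set
Consec [] = ⊤
Consec (x ∷ []) = ⊤
Consec (x ∷ y ∷ xs) = (hasDown x ≡ hasUp y) × Consec (y ∷ xs)

AlphaWord : ∀ {m} → Vec Letter m → Set
AlphaWord w = StartOK w × EndOK w × Consec w

ArcD : ∀ {m} → Vec Letter m → Vec Letter m → Set
ArcD {m} v u = (i : Fin m) → hasRight (lookup v i) ≡ hasLeft (lookup u i)

outletLetter : Letter → Bool
outletLetter a = true
outletLetter b = false
outletLetter c = true
outletLetter d = false
outletLetter e = true
outletLetter f = false

outlet : ∀ {m} → Vec Letter m → Vec Bool m
outlet [] = []
outlet (x ∷ xs) = outletLetter x ∷ outlet xs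

VertexD* : ∀ m → Vec Bool m → Set
VertexD* m x = Σ (Vec Letter m) λ α → AlphaWord α × outlet α ≡ x

ArcD* : ∀ m → Vec Bool m → Vec Bool m → Set
ArcD* m x y = Σ (Vec Letter m) λ v → Σ (Vec Letter m) λ u →
  AlphaWord v × AlphaWord u × outlet v ≡ x × outlet u ≡ y × ArcD v u

data Connected (m : ℕ) (x : Vec Bool m) : Vec Bool m → Set where
  here : Connected m x x
  fwd  : ∀ {y z} → Connected m x y → ArcD* m y z → Connected m x z
  bwd  : ∀ {y z} → Connected m x y → ArcD* m z y → Connected m x z

VertexR* : ∀ m → Vec Bool m → Set
VertexR* m x = VertexD* m (replicate m false) × Connected m (replicate m false) x

HasCard : ∀ {A : Set} → (A → Set) → ℕ → Set
HasCard {A} P n = Σ (List A) λ L → Unique L × (∀ x → (x ∈ L) ⇔ P x) × length L ≡ n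

RevRel : ∀ {m} → Vec Bool m → Vec Bool m → Set
RevRel x y = (y ≡ x) ⊎ (y ≡ reverse x)

HasRevClassCard : ∀ {m} → (Vec Bool m → Set) → ℕ → Set
HasRevClassCard {m} P n = Σ (List (Vec Bool m)) λ L →
  All P L × AllPairs (λ x y → ¬ RevRel x y) L ×
  (∀ x → P x → Any (RevRel x) L) × length L ≡ n

-- An arc x → y of D*_m is nothing but a column of letters with left edges x and right
-- edges y. Let the weight of a binary word be its Hamming distance to 0101⋯. Since every
-- letter has exactly two edges, a count along the column shows that weight x + weight y
-- = m + 1 for every arc when m = 2k+1, so the component of 0^m lies in the weight classes
-- k and k+2. Conversely, turning a factor 00 into 11 is a walk of length two in D*_m, and
-- these moves connect all words of equal weight; an arc leaves 0^m as soon as m ≥ 2. Hence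
-- |V(R*_m)| = C(m,k) + C(m,k+2) = C(m+1,k). Reversal preserves the weight, and counting a
-- list of class representatives gives 2·#classes = #words + #palindromes, the
-- palindromes of weight w numbering C(k,⌊w/2⌋).

module Submission where

open import Defs
open import Data.Bool using (Bool; true; false; not; _xor_)
open import Data.Bool.Properties using (not-involutive)
open import Data.Empty using (⊥; ⊥-elim)
import Data.Fin as Fin
open import Data.List using (List; []; _∷_; _++_; length; filter)
import Data.List as List
open import Data.List.Properties using (length-++; filter-++; filter-≐; filter-none)
open import Data.List.Membership.Propositional using (_∈_; lose; find)
open import Data.List.Membership.Propositional.Properties using (∈-map⁺; ∈-map⁻; ∈-++⁺ˡ; ∈-++⁺ʳ; ∈-filter⁺; ∈-filter⁻)
open import Data.List.Relation.Unary.All as All using (All)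
import Data.List.Relation.Unary.All.Properties as All
open import Data.List.Relation.Unary.Any as Any using (Any; here; there)
import Data.List.Relation.Unary.Any.Properties as Any
open import Data.List.Relation.Unary.AllPairs as AllPairs using (AllPairs)
import Data.List.Relation.Unary.AllPairs.Properties as AllPairs
open import Data.List.Relation.Unary.Unique.Propositional using (Unique)
import Data.List.Relation.Unary.Unique.Propositional.Properties as Unique
open import Data.Nat using (ℕ; zero; suc; _+_; _*_; _∸_; _≤_; _≟_; z≤n; s≤s; ⌊_/2⌋; ⌈_/2⌉; _/_; _%_)
open import Data.Nat.Properties
  using (+-identityʳ; +-suc; +-assoc; suc-injective; +-cancelˡ-≡; +-comm; +-mono-≤; *-zeroʳ; *-distribˡ-+; m+n∸n≡m; m+n∸m≡n; m≢1+n+m; m≤m*n; ⌊n/2⌋+⌈n/2⌉≡n; ⌊n/2⌋≤n; m≤n⇒m≤1+n)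
open import Data.Nat.DivMod using (m/n≡1+[m∸n]/n; m*n/n≡m; m/n/o≡m/[n*o]; m≡m%n+[m/n]*n)
open import Data.Nat.Combinatorics using (_C_; nCk+nC[k+1]≡[n+1]C[k+1]; nCk≡nC[n∸k])
open import Data.Nat.Tactic.RingSolver using (solve-∀)
open import Data.Product using (Σ; _×_; _,_; proj₁; proj₂)
open import Data.Sum using (_⊎_; inj₁; inj₂)
open import Data.Unit using (tt)
open import Data.Vec using (Vec; []; _∷_; lookup; replicate; reverse; _∷ʳ_; initLast)
import Data.Vec as Vec
open import Data.Vec.Properties using (lookup-map; reverse-∷; reverse-involutive; reverse-reverse; ∷-injective; ∷ʳ-injective)
open import Function.Base using (_∘_)
open import Function.Bundles using (_⇔_; mk⇔; Equivalence)
open import Level using (0ℓ)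
open import Relation.Binary.Core using (Rel)
open import Relation.Binary.Structures using (IsEquivalence)
open import Relation.Binary.Construct.Closure.Equivalence as EqClosure using (EqClosure)
open import Relation.Binary.Construct.Closure.ReflexiveTransitive using (ε; _◅_; _◅◅_)
import Relation.Binary.Construct.Closure.Symmetric as SymClosure
open import Relation.Binary.PropositionalEquality using (_≡_; _≢_; refl; sym; trans; cong; cong₂; subst)
open import Relation.Nullary using (¬_; Dec; yes; no; does)
open import Relation.Nullary.Decidable using (map′; _⊎-dec_)
open import Relation.Unary using (Pred; Decidable)
open Relation.Binary.PropositionalEquality.≡-Reasoning

-- Alpha-words as columns

lefts rights : ∀ {n} → Vec Letter n → Vec Bool n
lefts = Vec.map hasLeft
rights = Vec.map hasRight

-- A column of letters whose vertical edges fit together; s (t) records whether an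
-- edge leaves the column at the top (bottom).
Chain : ∀ {n} → Bool → Bool → Vec Letter n → Set
Chain s t [] = s ≡ t
Chain s t (x ∷ xs) = hasUp x ≡ s × Chain (hasDown x) t xs

firstOK⇔noUp : ∀ x → FirstOK x ⇔ (hasUp x ≡ false)
firstOK⇔noUp a = mk⇔ (λ _ → refl) (λ _ → tt)
firstOK⇔noUp b = mk⇔ (λ ()) (λ ())
firstOK⇔noUp c = mk⇔ (λ ()) (λ ())
firstOK⇔noUp d = mk⇔ (λ _ → refl) (λ _ → tt)
firstOK⇔noUp e = mk⇔ (λ _ → refl) (λ _ → tt)
firstOK⇔noUp f = mk⇔ (λ ()) (λ ())

lastOK⇔noDown : ∀ x → LastOK x ⇔ (hasDown x ≡ false)
lastOK⇔noDown a = mk⇔ (λ ()) (λ ())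
lastOK⇔noDown b = mk⇔ (λ ()) (λ ())
lastOK⇔noDown c = mk⇔ (λ _ → refl) (λ _ → tt)
lastOK⇔noDown d = mk⇔ (λ ()) (λ ())
lastOK⇔noDown e = mk⇔ (λ _ → refl) (λ _ → tt)
lastOK⇔noDown f = mk⇔ (λ _ → refl) (λ _ → tt)

chain⇒endOK×consec : ∀ {n s} x (xs : Vec Letter n) → Chain s false (x ∷ xs) → EndOK (x ∷ xs) × Consec (x ∷ xs)
chain⇒endOK×consec x [] (_ , noDown) = Equivalence.from (lastOK⇔noDown x) noDown , tt
chain⇒endOK×consec x (y ∷ ys) (_ , ch) =
  let end , consec = chain⇒endOK×consec y ys ch in end , sym (proj₁ ch) , consec

endOK×consec⇒chain : ∀ {n} x (xs : Vec Letter n) → EndOK (x ∷ xs) → Consec (x ∷ xs) → Chain (hasDown x) false xs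
endOK×consec⇒chain x [] end _ = Equivalence.to (lastOK⇔noDown x) end
endOK×consec⇒chain x (y ∷ ys) end (down≡up , consec) = sym down≡up , endOK×consec⇒chain y ys end consec

alphaWord⇔chain : ∀ {n} (w : Vec Letter n) → AlphaWord w ⇔ Chain false false w
alphaWord⇔chain [] = mk⇔ (λ _ → refl) (λ _ → tt , tt , tt)
alphaWord⇔chain (x ∷ xs) = mk⇔
  (λ (start , end , consec) → Equivalence.to (firstOK⇔noUp x) start , endOK×consec⇒chain x xs end consec)
  (λ ch → Equivalence.from (firstOK⇔noUp x) (proj₁ ch) , chain⇒endOK×consec x xs ch)

outlet≡rights : ∀ {n} (w : Vec Letter n) → outlet w ≡ rights w
outlet≡rights [] = refl
outlet≡rights (x ∷ xs) = cong₂ _∷_ (outletLetter≡hasRight x) (outlet≡rights xs)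
  where
  outletLetter≡hasRight : ∀ x → outletLetter x ≡ hasRight x
  outletLetter≡hasRight a = refl
  outletLetter≡hasRight b = refl
  outletLetter≡hasRight c = refl
  outletLetter≡hasRight d = refl
  outletLetter≡hasRight e = refl
  outletLetter≡hasRight f = refl

arcD⇒rights≡lefts : ∀ {n} (v u : Vec Letter n) → ArcD v u → rights v ≡ lefts u
arcD⇒rights≡lefts [] [] _ = refl
arcD⇒rights≡lefts (x ∷ xs) (y ∷ ys) arc = cong₂ _∷_ (arc Fin.zero) (arcD⇒rights≡lefts xs ys (arc ∘ Fin.suc))

mirrorLetter : Letter → Letter
mirrorLetter a = d
mirrorLetter b = b
mirrorLetter c = f
mirrorLetter d = a
mirrorLetter e = e
mirrorLetter f = c

hasUp-mirror : ∀ x → hasUp (mirrorLetter x) ≡ hasUp x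
hasUp-mirror a = refl
hasUp-mirror b = refl
hasUp-mirror c = refl
hasUp-mirror d = refl
hasUp-mirror e = refl
hasUp-mirror f = refl

hasDown-mirror : ∀ x → hasDown (mirrorLetter x) ≡ hasDown x
hasDown-mirror a = refl
hasDown-mirror b = refl
hasDown-mirror c = refl
hasDown-mirror d = refl
hasDown-mirror e = refl
hasDown-mirror f = refl

hasRight-mirror : ∀ x → hasRight (mirrorLetter x) ≡ hasLeft x
hasRight-mirror a = refl
hasRight-mirror b = refl
hasRight-mirror c = refl
hasRight-mirror d = refl
hasRight-mirror e = refl
hasRight-mirror f = refl

mirror : ∀ {n} → Vec Letter n → Vec Letter n
mirror = Vec.map mirrorLetter

chain-mirror : ∀ {n s t} (w : Vec Letter n) → Chain s t w → Chain s t (mirror w)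
chain-mirror [] s≡t = s≡t
chain-mirror {t = t} (x ∷ xs) (up , ch) =
  trans (hasUp-mirror x) up , subst (λ s → Chain s t (mirror xs)) (sym (hasDown-mirror x)) (chain-mirror xs ch)

rights-mirror : ∀ {n} (w : Vec Letter n) → rights (mirror w) ≡ lefts w
rights-mirror [] = refl
rights-mirror (x ∷ xs) = cong₂ _∷_ (hasRight-mirror x) (rights-mirror xs)

arcD-mirror : ∀ {n} (u : Vec Letter n) → ArcD (mirror u) u
arcD-mirror u i = trans (cong hasRight (lookup-map i mirrorLetter u)) (hasRight-mirror (lookup u i))

Column : ∀ {n} → Vec Bool n → Vec Bool n → Set
Column {n} x y = Σ (Vec Letter n) λ u → Chain false false u × lefts u ≡ x × rights u ≡ y

-- An arc x → y of D*_m amounts to a column with sides x and y: its source alpha-word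
-- can always be taken to be the mirror image of its target.
column⇒arcD* : ∀ {m} {x y : Vec Bool m} → Column x y → ArcD* m x y
column⇒arcD* (u , ch , refl , refl) =
  mirror u , u ,
  Equivalence.from (alphaWord⇔chain (mirror u)) (chain-mirror u ch) ,
  Equivalence.from (alphaWord⇔chain u) ch ,
  trans (outlet≡rights (mirror u)) (rights-mirror u) , outlet≡rights u , arcD-mirror u

arcD*⇒column : ∀ {m} {x y : Vec Bool m} → ArcD* m x y → Column x y
arcD*⇒column (v , u , _ , αu , refl , refl , arc) =
  u , Equivalence.to (alphaWord⇔chain u) αu ,
  trans (sym (arcD⇒rights≡lefts v u arc)) (sym (outlet≡rights v)) , sym (outlet≡rights u)

-- The weight invariant

bit : Bool → ℕ
bit false = 0
bit true = 1

alternating : Bool → ℕ → Bool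
alternating p zero = p
alternating p (suc n) = alternating (not p) n

weight : ∀ {n} → Bool → Vec Bool n → ℕ
weight p [] = 0
weight p (x ∷ xs) = bit (x xor p) + weight (not p) xs

-- Each letter has exactly two of its four edges.
letter-degree : ∀ p x → bit (hasLeft x xor p) + bit (hasRight x xor p) + bit (hasUp x xor p) ≡ 1 + bit (hasDown x xor not p)
letter-degree false a = refl
letter-degree false b = refl
letter-degree false c = refl
letter-degree false d = refl
letter-degree false e = refl
letter-degree false f = refl
letter-degree true a = refl
letter-degree true b = refl
letter-degree true c = refl
letter-degree true d = refl
letter-degree true e = refl
letter-degree true f = refl

chain-weight : ∀ {n s t} p (u : Vec Letter n) → Chain s t u →
  weight p (lefts u) + weight p (rights u) + bit (s xor p) ≡ n + bit (t xor alternating p n)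
chain-weight p [] refl = refl
chain-weight {suc n} {t = t} p (x ∷ u) (refl , ch) = begin
  (l + L) + (r + R) + bit (hasUp x xor p)  ≡⟨ regroup l L r R (bit (hasUp x xor p)) ⟩
  (l + r + bit (hasUp x xor p)) + (L + R)  ≡⟨ cong (_+ (L + R)) (letter-degree p x) ⟩
  1 + bit (hasDown x xor not p) + (L + R)  ≡⟨ cong suc (trans (+-comm _ (L + R)) (chain-weight (not p) u ch)) ⟩
  suc n + bit (t xor alternating (not p) n) ∎
  where
  l = bit (hasLeft x xor p)
  r = bit (hasRight x xor p)
  L = weight (not p) (lefts u)
  R = weight (not p) (rights u)
  regroup : ∀ l L r R s → (l + L) + (r + R) + s ≡ (l + r + s) + (L + R)
  regroup = solve-∀

arcD*-weight : ∀ {m} {x y : Vec Bool m} → ArcD* m x y → weight false x + weight false y ≡ m + bit (alternating false m)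
arcD*-weight arc with arcD*⇒column arc
... | u , ch , refl , refl = trans (sym (+-identityʳ _)) (chain-weight false u ch)

oddLen : ℕ → ℕ
oddLen k = 1 + k * 2

alternating-oddLen : ∀ p k → alternating p (oddLen k) ≡ not p
alternating-oddLen p zero = refl
alternating-oddLen false (suc k) = alternating-oddLen false k
alternating-oddLen true (suc k) = alternating-oddLen true k

weight-zeros : ∀ k → weight false (replicate (oddLen k) false) ≡ k
weight-zeros zero = refl
weight-zeros (suc k) = cong suc (weight-zeros k)

arcD*-sum : ∀ k {x y : Vec Bool (oddLen k)} → ArcD* (oddLen k) x y → weight false x + weight false y ≡ k + suc (suc k)
arcD*-sum k arc = trans (arcD*-weight arc) (trans (cong (λ p → oddLen k + bit p) (alternating-oddLen false k)) (oddLen+1 k))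
  where
  oddLen+1 : ∀ k → 1 + k * 2 + 1 ≡ k + suc (suc k)
  oddLen+1 = solve-∀

Level : ℕ → ℕ → Set
Level k w = w ≡ k ⊎ w ≡ suc (suc k)

level-partner : ∀ k {v w} → v + w ≡ k + suc (suc k) → Level k v → Level k w
level-partner k {w = w} sum (inj₁ refl) = inj₂ (+-cancelˡ-≡ k w _ sum)
level-partner k {w = w} sum (inj₂ refl) = inj₁ (+-cancelˡ-≡ (suc (suc k)) w k (trans sum (+-comm k _)))

-- The component of 0^m

connected-trans : ∀ {m x y z} → Connected m x y → Connected m y z → Connected m x z
connected-trans p here = p
connected-trans p (fwd q arc) = fwd (connected-trans p q) arc
connected-trans p (bwd q arc) = bwd (connected-trans p q) arc

connected-sym : ∀ {m x y} → Connected m x y → Connected m y x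
connected-sym here = here
connected-sym (fwd p arc) = connected-trans (bwd here arc) (connected-sym p)
connected-sym (bwd p arc) = connected-trans (fwd here arc) (connected-sym p)

connected-isEquivalence : ∀ m → IsEquivalence (Connected m)
connected-isEquivalence m = record { refl = here ; sym = connected-sym ; trans = connected-trans }

connected⇒level : ∀ k {x} → Connected (oddLen k) (replicate (oddLen k) false) x → Level k (weight false x)
connected⇒level k here = inj₁ (weight-zeros k)
connected⇒level k (fwd p arc) = level-partner k (arcD*-sum k arc) (connected⇒level k p)
connected⇒level k (bwd {y} {z} p arc) =
  level-partner k (trans (+-comm (weight false y) (weight false z)) (arcD*-sum k arc)) (connected⇒level k p)

data Flip : ∀ {n} → Vec Bool n → Vec Bool n → Set where
  pair : ∀ {n} (q : Vec Bool n) → Flip (false ∷ false ∷ q) (true ∷ true ∷ q)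
  skip : ∀ {n} p {x y : Vec Bool n} → Flip x y → Flip (p ∷ x) (p ∷ y)

_≈_ : ∀ {n} → Rel (Vec Bool n) 0ℓ
_≈_ = EqClosure Flip

≈-cons : ∀ {n} p {x y : Vec Bool n} → x ≈ y → (p ∷ x) ≈ (p ∷ y)
≈-cons p = EqClosure.gmap (p ∷_) (skip p)

letter-with-left-down : ∀ l t → Σ Letter λ x → hasLeft x ≡ l × hasDown x ≡ t
letter-with-left-down false false = c , refl , refl
letter-with-left-down false true = a , refl , refl
letter-with-left-down true false = e , refl , refl
letter-with-left-down true true = d , refl , refl

letter-with-up-left : ∀ s l → Σ Letter λ x → hasUp x ≡ s × hasLeft x ≡ l
letter-with-up-left false false = a , refl , refl
letter-with-up-left false true = e , refl , refl
letter-with-up-left true false = b , refl , refl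
letter-with-up-left true true = f , refl , refl

chain-with-lefts : ∀ {n} (q : Vec Bool n) → Σ Bool λ τ → Σ (Vec Letter n) λ S → Chain τ false S × lefts S ≡ q
chain-with-lefts [] = false , [] , refl , refl
chain-with-lefts (l ∷ q) with chain-with-lefts q
... | τ , S , ch , refl with letter-with-left-down l τ
... | x , refl , refl = hasUp x , x ∷ S , (refl , ch) , refl

-- A flip is realised by two columns with the same right side, so x and y have a common out-neighbour.
flip-columns : ∀ {n} {x y : Vec Bool n} → Flip x y → ∀ σ →
  Σ (Vec Letter n) λ u → Σ (Vec Letter n) λ v →
  Chain σ false u × Chain σ false v × lefts u ≡ x × lefts v ≡ y × rights u ≡ rights v
flip-columns (pair q) σ with chain-with-lefts q
flip-columns (pair q) false | false , S , ch , refl = a ∷ c ∷ S , e ∷ e ∷ S , (refl , refl , ch) , (refl , refl , ch) , refl , refl , refl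
flip-columns (pair q) false | true , S , ch , refl = a ∷ b ∷ S , e ∷ d ∷ S , (refl , refl , ch) , (refl , refl , ch) , refl , refl , refl
flip-columns (pair q) true | false , S , ch , refl = b ∷ c ∷ S , f ∷ e ∷ S , (refl , refl , ch) , (refl , refl , ch) , refl , refl , refl
flip-columns (pair q) true | true , S , ch , refl = b ∷ b ∷ S , f ∷ d ∷ S , (refl , refl , ch) , (refl , refl , ch) , refl , refl , refl
flip-columns (skip l fl) σ with letter-with-up-left σ l
... | x , refl , refl with flip-columns fl (hasDown x)
... | u , v , chu , chv , refl , refl , ru≡rv = x ∷ u , x ∷ v , (refl , chu) , (refl , chv) , refl , refl , cong (hasRight x ∷_) ru≡rv

flip⇒connected : ∀ {m} {x y : Vec Bool m} → Flip x y → Connected m x y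
flip⇒connected fl with flip-columns fl false
... | u , v , chu , chv , refl , refl , ru≡rv =
  bwd (fwd here (column⇒arcD* (u , chu , refl , refl))) (column⇒arcD* (v , chv , refl , sym ru≡rv))

≈⇒connected : ∀ {m} {x y : Vec Bool m} → x ≈ y → Connected m x y
≈⇒connected {m} = EqClosure.fold (connected-isEquivalence m) flip⇒connected

canonical : Bool → (n w : ℕ) → Vec Bool n
canonical p zero w = []
canonical p (suc n) zero = p ∷ canonical (not p) n zero
canonical p (suc n) (suc w) = not p ∷ canonical (not p) n w

canonical-cons : ∀ p n w → w ≤ n → (p ∷ canonical (not p) n w) ≈ canonical p (suc n) w
canonical-cons p n zero _ = ε
canonical-cons false (suc n) (suc w) (s≤s w≤n) =
  SymClosure.fwd (pair (canonical false n w)) ◅ ≈-cons true (canonical-cons true n w w≤n)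
canonical-cons true (suc n) (suc w) (s≤s w≤n) =
  SymClosure.bwd (pair (canonical true n w)) ◅ ≈-cons false (canonical-cons false n w w≤n)

bit≤1 : ∀ p → bit p ≤ 1
bit≤1 false = z≤n
bit≤1 true = s≤s z≤n

weight≤length : ∀ {n} p (x : Vec Bool n) → weight p x ≤ n
weight≤length p [] = z≤n
weight≤length p (x ∷ xs) = +-mono-≤ (bit≤1 (x xor p)) (weight≤length (not p) xs)

≈canonical : ∀ {n} p (x : Vec Bool n) → x ≈ canonical p n (weight p x)
≈canonical p [] = ε
≈canonical false (false ∷ xs) = ≈-cons false (≈canonical true xs) ◅◅ canonical-cons false _ _ (weight≤length true xs)
≈canonical false (true ∷ xs) = ≈-cons true (≈canonical true xs)
≈canonical true (false ∷ xs) = ≈-cons false (≈canonical false xs)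
≈canonical true (true ∷ xs) = ≈-cons true (≈canonical false xs) ◅◅ canonical-cons true _ _ (weight≤length false xs)

weight≡⇒≈ : ∀ {n} {x y : Vec Bool n} → weight false x ≡ weight false y → x ≈ y
weight≡⇒≈ {n} {x} {y} eq =
  ≈canonical false x ◅◅ subst (λ w → canonical false n w ≈ y) (sym eq) (EqClosure.symmetric Flip (≈canonical false y))

descent : ∀ n → Vec Letter (suc n)
descent zero = c ∷ []
descent (suc n) = b ∷ descent n

chain-descent : ∀ n → Chain true false (descent n)
chain-descent zero = refl , refl
chain-descent (suc n) = refl , chain-descent n

lefts-descent : ∀ n → lefts (descent n) ≡ replicate (suc n) false
lefts-descent zero = refl
lefts-descent (suc n) = cong (false ∷_) (lefts-descent n)

-- The column a b ⋯ b c; for m = 1 there is no arc leaving 0^m.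
arc-from-zeros : ∀ n → Σ (Vec Bool (suc (suc n))) (ArcD* (suc (suc n)) (replicate (suc (suc n)) false))
arc-from-zeros n = rights (a ∷ descent n) , column⇒arcD* (a ∷ descent n , (refl , chain-descent n) , cong (false ∷_) (lefts-descent n) , refl)

vertexR*⇔level : ∀ k {x} → VertexR* (oddLen (suc k)) x ⇔ Level (suc k) (weight false x)
vertexR*⇔level k {x} = mk⇔ (connected⇒level (suc k) ∘ proj₂) (λ lv → zeros-vertex , connect lv)
  where
  zeros = replicate (oddLen (suc k)) false
  y = proj₁ (arc-from-zeros (oddLen k))
  arc = proj₂ (arc-from-zeros (oddLen k))
  zeros-vertex : VertexD* (oddLen (suc k)) zeros
  zeros-vertex = let v , _ , αv , _ , ov , _ = arc in v , αv , ov
  weight-y : weight false y ≡ suc (suc (suc k))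
  weight-y = +-cancelˡ-≡ (suc k) _ _ (subst (λ w → w + weight false y ≡ suc k + suc (suc (suc k))) (weight-zeros (suc k)) (arcD*-sum (suc k) arc))
  connect : Level (suc k) (weight false x) → Connected (oddLen (suc k)) zeros x
  connect (inj₁ eq) = ≈⇒connected (weight≡⇒≈ (trans (weight-zeros (suc k)) (sym eq)))
  connect (inj₂ eq) = connected-trans (fwd here arc) (≈⇒connected (weight≡⇒≈ (trans weight-y (sym eq))))

-- Counting words by weight

shift : ℕ → (ℕ → ℕ) → ℕ → ℕ
shift zero φ w = φ w
shift (suc i) φ zero = 0
shift (suc i) φ (suc w) = shift i φ w

shift-cong : ∀ i {φ ψ : ℕ → ℕ} → (∀ v → φ v ≡ ψ v) → ∀ w → shift i φ w ≡ shift i ψ w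
shift-cong zero eq w = eq w
shift-cong (suc i) eq zero = refl
shift-cong (suc i) eq (suc w) = shift-cong i eq w

shift-+ : ∀ i (φ ψ : ℕ → ℕ) w → shift i (λ v → φ v + ψ v) w ≡ shift i φ w + shift i ψ w
shift-+ zero φ ψ w = refl
shift-+ (suc i) φ ψ zero = refl
shift-+ (suc i) φ ψ (suc w) = shift-+ i φ ψ w

shift-* : ∀ i n (φ : ℕ → ℕ) w → shift i (λ v → n * φ v) w ≡ n * shift i φ w
shift-* zero n φ w = refl
shift-* (suc i) n φ zero = sym (*-zeroʳ n)
shift-* (suc i) n φ (suc w) = shift-* i n φ w

shift-shift : ∀ i j (φ : ℕ → ℕ) w → shift i (shift j φ) w ≡ shift (i + j) φ w
shift-shift zero j φ w = refl
shift-shift (suc i) j φ zero = refl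
shift-shift (suc i) j φ (suc w) = shift-shift i j φ w

shift-half : ∀ (φ : ℕ → ℕ) w → shift 2 (λ v → φ ⌊ v /2⌋) w ≡ shift 1 φ ⌊ w /2⌋
shift-half φ zero = refl
shift-half φ (suc zero) = refl
shift-half φ (suc (suc w)) = refl

shift-bit : ∀ p (φ : ℕ → ℕ) w → shift (bit p) φ w + shift (bit (not p)) φ w ≡ φ w + shift 1 φ w
shift-bit false φ w = refl
shift-bit true φ w = +-comm (shift 1 φ w) (φ w)

shift-double-bit : ∀ p (φ : ℕ → ℕ) w → shift (bit p + bit p) φ w + shift (bit (not p) + bit (not p)) φ w ≡ φ w + shift 2 φ w
shift-double-bit false φ w = refl
shift-double-bit true φ w = +-comm (shift 2 φ w) (φ w)

C-pascal : ∀ n w → suc n C w ≡ n C w + shift 1 (n C_) w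
C-pascal n zero = refl
C-pascal n (suc w) = trans (sym (nCk+nC[k+1]≡[n+1]C[k+1] n w)) (+-comm (n C w) (n C suc w))

C-pascal₂ : ∀ n w → suc (suc n) C w ≡ n C w + (shift 1 (n C_) w + shift 1 (n C_) w) + shift 2 (n C_) w
C-pascal₂ n w = begin
  suc (suc n) C w                                                       ≡⟨ C-pascal (suc n) w ⟩
  suc n C w + shift 1 (suc n C_) w                                      ≡⟨ cong₂ _+_ (C-pascal n w) (shift-cong 1 (C-pascal n) w) ⟩
  (n C w + s₁ w) + shift 1 (λ v → n C v + s₁ v) w                      ≡⟨ cong ((n C w + s₁ w) +_) (shift-+ 1 (n C_) s₁ w) ⟩
  (n C w + s₁ w) + (s₁ w + shift 1 s₁ w)                                ≡⟨ cong (λ z → (n C w + s₁ w) + (s₁ w + z)) (shift-shift 1 1 (n C_) w) ⟩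
  (n C w + s₁ w) + (s₁ w + shift 2 (n C_) w)                            ≡⟨ regroup (n C w) (s₁ w) (shift 2 (n C_) w) ⟩
  n C w + (s₁ w + s₁ w) + shift 2 (n C_) w                              ∎
  where
  s₁ = shift 1 (n C_)
  regroup : ∀ x y z → (x + y) + (y + z) ≡ x + (y + y) + z
  regroup = solve-∀

count : ∀ {A : Set} → (A → ℕ) → ℕ → List A → ℕ
count h w xs = length (filter (λ x → h x ≟ w) xs)

module _ {A : Set} where

  count-++ : ∀ {h : A → ℕ} {w} xs ys → count h w (xs ++ ys) ≡ count h w xs + count h w ys
  count-++ {h} {w} xs ys = trans (cong length (filter-++ (λ x → h x ≟ w) xs ys)) (length-++ (filter (λ x → h x ≟ w) xs))

  count-cong : ∀ {h h′ : A → ℕ} w xs → (∀ x → h x ≡ h′ x) → count h w xs ≡ count h′ w xs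
  count-cong {h} {h′} w xs eq =
    cong length (filter-≐ (λ x → h x ≟ w) (λ x → h′ x ≟ w) ((λ {x} → trans (sym (eq x))) , (λ {x} → trans (eq x))) xs)

  count-map : ∀ {B : Set} (h : B → ℕ) (g : A → B) w xs → count h w (List.map g xs) ≡ count (h ∘ g) w xs
  count-map h g w [] = refl
  count-map h g w (x ∷ xs) with does (h (g x) ≟ w)
  ... | true = cong suc (count-map h g w xs)
  ... | false = count-map h g w xs

  length-filter-⊎ : ∀ {P Q : Pred A 0ℓ} (P? : Decidable P) (Q? : Decidable Q) → (∀ {x} → P x → ¬ Q x) → ∀ xs →
    length (filter (λ x → P? x ⊎-dec Q? x) xs) ≡ length (filter P? xs) + length (filter Q? xs)
  length-filter-⊎ P? Q? disjoint [] = refl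
  length-filter-⊎ P? Q? disjoint (x ∷ xs) with P? x | Q? x
  ... | yes p | yes q = ⊥-elim (disjoint p q)
  ... | yes _ | no _ = cong suc (length-filter-⊎ P? Q? disjoint xs)
  ... | no _ | yes _ = trans (cong suc (length-filter-⊎ P? Q? disjoint xs)) (sym (+-suc _ _))
  ... | no _ | no _ = length-filter-⊎ P? Q? disjoint xs

  count-shift : ∀ (h : A → ℕ) i w xs → count (λ x → i + h x) w xs ≡ shift i (λ v → count h v xs) w
  count-shift h zero w xs = refl
  count-shift h (suc i) zero xs = cong length (filter-none (λ x → suc (i + h x) ≟ 0) (All.universal (λ _ ()) xs))
  count-shift h (suc i) (suc w) xs =
    trans (cong length (filter-≐ (λ x → suc (i + h x) ≟ suc w) (λ x → i + h x ≟ w) (suc-injective , cong suc) xs))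
          (count-shift h i w xs)

  count-map-shift : ∀ {B : Set} (h : B → ℕ) {h′ : A → ℕ} (g : A → B) i w xs → (∀ x → h (g x) ≡ i + h′ x) →
    count h w (List.map g xs) ≡ shift i (λ v → count h′ v xs) w
  count-map-shift h {h′} g i w xs eq =
    trans (count-map h g w xs) (trans (count-cong w xs eq) (count-shift h′ i w xs))

allVectors : ∀ n → List (Vec Bool n)
allVectors zero = [] ∷ []
allVectors (suc n) = List.map (false ∷_) (allVectors n) ++ List.map (true ∷_) (allVectors n)

∈-allVectors : ∀ {n} (x : Vec Bool n) → x ∈ allVectors n
∈-allVectors [] = here refl
∈-allVectors (false ∷ x) = ∈-++⁺ˡ (∈-map⁺ (false ∷_) (∈-allVectors x))
∈-allVectors (true ∷ x) = ∈-++⁺ʳ _ (∈-map⁺ (true ∷_) (∈-allVectors x))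

allVectors-unique : ∀ n → Unique (allVectors n)
allVectors-unique zero = All.[] AllPairs.∷ AllPairs.[]
allVectors-unique (suc n) =
  Unique.++⁺ (Unique.map⁺ (proj₂ ∘ ∷-injective) (allVectors-unique n))
             (Unique.map⁺ (proj₂ ∘ ∷-injective) (allVectors-unique n)) heads-differ
  where
  heads-differ : ∀ {v} → v ∈ List.map (false ∷_) (allVectors n) × v ∈ List.map (true ∷_) (allVectors n) → ⊥
  heads-differ (p , q) with ∈-map⁻ (false ∷_) p | ∈-map⁻ (true ∷_) q
  ... | _ , _ , refl | _ , _ , ()

count-allVectors : ∀ n p w → count (weight p) w (allVectors n) ≡ n C w
count-allVectors zero p zero = refl
count-allVectors zero p (suc w) = refl
count-allVectors (suc n) p w = begin
  count (weight p) w (List.map (false ∷_) (allVectors n) ++ List.map (true ∷_) (allVectors n))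
    ≡⟨ count-++ (List.map (false ∷_) (allVectors n)) (List.map (true ∷_) (allVectors n)) ⟩
  count (weight p) w (List.map (false ∷_) (allVectors n)) + count (weight p) w (List.map (true ∷_) (allVectors n))
    ≡⟨ cong₂ _+_ (count-map-shift (weight p) (false ∷_) (bit p) w (allVectors n) (λ _ → refl))
                 (count-map-shift (weight p) (true ∷_) (bit (not p)) w (allVectors n) (λ _ → refl)) ⟩
  shift (bit p) (λ v → count (weight (not p)) v (allVectors n)) w + shift (bit (not p)) (λ v → count (weight (not p)) v (allVectors n)) w
    ≡⟨ cong₂ _+_ (shift-cong (bit p) (count-allVectors n (not p)) w) (shift-cong (bit (not p)) (count-allVectors n (not p)) w) ⟩
  shift (bit p) (n C_) w + shift (bit (not p)) (n C_) w
    ≡⟨ trans (shift-bit p (n C_) w) (sym (C-pascal n w)) ⟩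
  suc n C w ∎

-- Representatives of reversal classes

wrap : ∀ {n} → Bool → Vec Bool n → Bool → Vec Bool (suc (suc n))
wrap l y r = l ∷ (y ∷ʳ r)

unwrap : ∀ {n} (x : Vec Bool (suc (suc n))) → Σ Bool λ l → Σ (Vec Bool n) λ y → Σ Bool λ r → x ≡ wrap l y r
unwrap (l ∷ x) with initLast x
... | y , r , refl = l , y , r , refl

wrap-injective : ∀ {n l l′ r r′} {y y′ : Vec Bool n} → wrap l y r ≡ wrap l′ y′ r′ → l ≡ l′ × y ≡ y′ × r ≡ r′
wrap-injective {y = y} {y′} eq with ∷-injective eq
... | refl , eq′ with ∷ʳ-injective y y′ eq′
... | refl , refl = refl , refl , refl

reverse-wrap : ∀ {n} l (y : Vec Bool n) r → reverse (wrap l y r) ≡ wrap r (reverse y) l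
reverse-wrap l y r = begin
  reverse (l ∷ (y ∷ʳ r))      ≡⟨ reverse-∷ l (y ∷ʳ r) ⟩
  reverse (y ∷ʳ r) ∷ʳ l       ≡⟨ cong (_∷ʳ l) (reverse-reverse {xs = r ∷ reverse y} (trans (reverse-∷ r (reverse y)) (cong (_∷ʳ r) (reverse-involutive y)))) ⟩
  (r ∷ reverse y) ∷ʳ l        ∎

weight-snoc : ∀ {n} p (y : Vec Bool n) r → weight p (y ∷ʳ r) ≡ weight p y + bit (r xor alternating p n)
weight-snoc p [] r = +-identityʳ (bit (r xor p))
weight-snoc p (x ∷ y) r = trans (cong (bit (x xor p) +_) (weight-snoc (not p) y r)) (sym (+-assoc (bit (x xor p)) _ _))

weight-wrap : ∀ k p l r (y : Vec Bool (oddLen k)) → weight p (wrap l y r) ≡ bit (l xor p) + bit (r xor p) + weight (not p) y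
weight-wrap k p l r y = begin
  bit (l xor p) + weight (not p) (y ∷ʳ r)                                  ≡⟨ cong (bit (l xor p) +_) (weight-snoc (not p) y r) ⟩
  bit (l xor p) + (weight (not p) y + bit (r xor alternating (not p) (oddLen k)))
    ≡⟨ cong (λ q → bit (l xor p) + (weight (not p) y + bit (r xor q))) (trans (alternating-oddLen (not p) k) (not-involutive p)) ⟩
  bit (l xor p) + (weight (not p) y + bit (r xor p))                      ≡⟨ regroup (bit (l xor p)) (weight (not p) y) (bit (r xor p)) ⟩
  bit (l xor p) + bit (r xor p) + weight (not p) y                        ∎
  where
  regroup : ∀ x y z → x + (y + z) ≡ x + z + y
  regroup = solve-∀

weight-reverse : ∀ k p (x : Vec Bool (oddLen k)) → weight p (reverse x) ≡ weight p x
weight-reverse zero p (x ∷ []) = refl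
weight-reverse (suc k) p x with unwrap x
... | l , y , r , refl = begin
  weight p (reverse (wrap l y r))                       ≡⟨ cong (weight p) (reverse-wrap l y r) ⟩
  weight p (wrap r (reverse y) l)                       ≡⟨ weight-wrap k p r l (reverse y) ⟩
  bit (r xor p) + bit (l xor p) + weight (not p) (reverse y)
    ≡⟨ cong₂ _+_ (+-comm (bit (r xor p)) (bit (l xor p))) (weight-reverse k (not p) y) ⟩
  bit (l xor p) + bit (r xor p) + weight (not p) y      ≡⟨ sym (weight-wrap k p l r y) ⟩
  weight p (wrap l y r)                                 ∎

weight-revRel : ∀ k p {x y : Vec Bool (oddLen k)} → RevRel x y → weight p y ≡ weight p x
weight-revRel k p (inj₁ refl) = refl
weight-revRel k p {x} (inj₂ refl) = weight-reverse k p x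

revRel-wrap : ∀ {n l l′ r r′} {y y′ : Vec Bool n} → RevRel (wrap l y r) (wrap l′ y′ r′) →
  (l′ ≡ l × y′ ≡ y × r′ ≡ r) ⊎ (l′ ≡ r × y′ ≡ reverse y × r′ ≡ l)
revRel-wrap (inj₁ eq) = inj₁ (wrap-injective eq)
revRel-wrap {l = l} {r = r} {y = y} (inj₂ eq) = inj₂ (wrap-injective (trans eq (reverse-wrap l y r)))

revRel-wrap⁺ : ∀ {n} l {y y′ : Vec Bool n} → RevRel y y′ → RevRel (wrap l y l) (wrap l y′ l)
revRel-wrap⁺ l (inj₁ refl) = inj₁ refl
revRel-wrap⁺ l {y} (inj₂ refl) = inj₂ (sym (reverse-wrap l y l))

withEnds : ∀ {n} → Bool → Bool → List (Vec Bool n) → List (Vec Bool (suc (suc n)))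
withEnds l r = List.map (λ y → wrap l y r)

-- A word 1y0 is represented by its reversal 0ȳ1; words with equal ends are represented recursively.
reps : ∀ k → List (Vec Bool (oddLen k))
reps zero = (false ∷ []) ∷ (true ∷ []) ∷ []
reps (suc k) = withEnds false true (allVectors (oddLen k)) ++ (withEnds false false (reps k) ++ withEnds true true (reps k))

Unrelated : ∀ {n} → Vec Bool n → Vec Bool n → Set
Unrelated x y = ¬ RevRel x y

unrelated-01 : ∀ {n} {y y′ : Vec Bool n} → y ≢ y′ → Unrelated (wrap false y true) (wrap false y′ true)
unrelated-01 y≢y′ r with revRel-wrap r
... | inj₁ (_ , y′≡y , _) = y≢y′ (sym y′≡y)
... | inj₂ (() , _)

unrelated-same-ends : ∀ {n} l {y y′ : Vec Bool n} → Unrelated y y′ → Unrelated (wrap l y l) (wrap l y′ l)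
unrelated-same-ends l y≁y′ r with revRel-wrap r
... | inj₁ (_ , y′≡y , _) = y≁y′ (inj₁ y′≡y)
... | inj₂ (_ , y′≡ȳ , _) = y≁y′ (inj₂ y′≡ȳ)

unrelated-01-00 : ∀ {n} (y y′ : Vec Bool n) → Unrelated (wrap false y true) (wrap false y′ false)
unrelated-01-00 y y′ r with revRel-wrap r
... | inj₁ (_ , _ , ())
... | inj₂ (() , _)

unrelated-01-11 : ∀ {n} (y y′ : Vec Bool n) → Unrelated (wrap false y true) (wrap true y′ true)
unrelated-01-11 y y′ r with revRel-wrap r
... | inj₁ (() , _)
... | inj₂ (_ , _ , ())

unrelated-00-11 : ∀ {n} (y y′ : Vec Bool n) → Unrelated (wrap false y false) (wrap true y′ true)
unrelated-00-11 y y′ r with revRel-wrap r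
... | inj₁ (() , _)
... | inj₂ (() , _)

all-map⁺-universal : ∀ {A B : Set} {P : B → Set} (ψ : A → B) → (∀ y → P (ψ y)) → ∀ ys → All P (List.map ψ ys)
all-map⁺-universal ψ p ys = All.map⁺ (All.universal p ys)

reps-unrelated : ∀ k → AllPairs Unrelated (reps k)
reps-unrelated zero = ((λ { (inj₁ ()) ; (inj₂ ()) }) All.∷ All.[]) AllPairs.∷ (All.[] AllPairs.∷ AllPairs.[])
reps-unrelated (suc k) =
  AllPairs.++⁺ (AllPairs.map⁺ (AllPairs.map unrelated-01 (allVectors-unique (oddLen k))))
    (AllPairs.++⁺ (AllPairs.map⁺ (AllPairs.map (unrelated-same-ends false) (reps-unrelated k)))
                  (AllPairs.map⁺ (AllPairs.map (unrelated-same-ends true) (reps-unrelated k)))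
                  (all-map⁺-universal _ (λ y → all-map⁺-universal _ (unrelated-00-11 y) (reps k)) (reps k)))
    (all-map⁺-universal _ (λ y → All.++⁺ (all-map⁺-universal _ (unrelated-01-00 y) (reps k))
                                         (all-map⁺-universal _ (unrelated-01-11 y) (reps k)))
                       (allVectors (oddLen k)))

reps-cover : ∀ k (x : Vec Bool (oddLen k)) → Any (RevRel x) (reps k)
reps-cover zero (false ∷ []) = here (inj₁ refl)
reps-cover zero (true ∷ []) = there (here (inj₁ refl))
reps-cover (suc k) x with unwrap x
... | false , y , true , refl = Any.++⁺ˡ (Any.map⁺ (lose (∈-allVectors y) (inj₁ refl)))
... | true , y , false , refl = Any.++⁺ˡ (Any.map⁺ (lose (∈-allVectors (reverse y)) (inj₂ (sym (reverse-wrap true y false)))))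
... | false , y , false , refl = Any.++⁺ʳ (withEnds false true (allVectors (oddLen k))) (Any.++⁺ˡ (Any.map⁺ (Any.map (revRel-wrap⁺ false) (reps-cover k y))))
... | true , y , true , refl =
  Any.++⁺ʳ (withEnds false true (allVectors (oddLen k))) (Any.++⁺ʳ (withEnds false false (reps k)) (Any.map⁺ (Any.map (revRel-wrap⁺ true) (reps-cover k y))))

bit-complement : ∀ p → bit p + bit (not p) ≡ 1
bit-complement false = refl
bit-complement true = refl

count-withEnds : ∀ k p l r w (ys : List (Vec Bool (oddLen k))) →
  count (weight p) w (withEnds l r ys) ≡ shift (bit (l xor p) + bit (r xor p)) (λ v → count (weight (not p)) v ys) w
count-withEnds k p l r w ys = count-map-shift (weight p) (λ y → wrap l y r) (bit (l xor p) + bit (r xor p)) w ys (weight-wrap k p l r)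

reps-count : ∀ k p w → 2 * count (weight p) w (reps k) ≡ oddLen k C w + k C ⌊ w /2⌋
reps-count zero false zero = refl
reps-count zero false (suc zero) = refl
reps-count zero false (suc (suc w)) = refl
reps-count zero true zero = refl
reps-count zero true (suc zero) = refl
reps-count zero true (suc (suc w)) = refl
reps-count (suc k) p w = begin
  2 * count (weight p) w (E01 ++ (E00 ++ E11))
    ≡⟨ cong (2 *_) (trans (count-++ E01 (E00 ++ E11)) (cong (count (weight p) w E01 +_) (count-++ E00 E11))) ⟩
  2 * (count (weight p) w E01 + (count (weight p) w E00 + count (weight p) w E11))
    ≡⟨ distrib (count (weight p) w E01) (count (weight p) w E00) (count (weight p) w E11) ⟩
  2 * count (weight p) w E01 + (2 * count (weight p) w E00 + 2 * count (weight p) w E11)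
    ≡⟨ cong₂ _+_ (cong (2 *_) count-01) (trans (cong₂ _+_ (twice-count-equal-ends false) (twice-count-equal-ends true))
                                                (shift-double-bit p g w)) ⟩
  2 * s₁ + (g w + shift 2 g w)
    ≡⟨ cong (λ z → 2 * s₁ + (g w + z)) (trans (shift-+ 2 (n C_) (λ v → k C ⌊ v /2⌋) w)
                                               (cong (shift 2 (n C_) w +_) (shift-half (k C_) w))) ⟩
  2 * s₁ + ((n C w + k C ⌊ w /2⌋) + (shift 2 (n C_) w + shift 1 (k C_) ⌊ w /2⌋))
    ≡⟨ regroup s₁ (n C w) (k C ⌊ w /2⌋) (shift 2 (n C_) w) (shift 1 (k C_) ⌊ w /2⌋) ⟩
  (n C w + (s₁ + s₁) + shift 2 (n C_) w) + (k C ⌊ w /2⌋ + shift 1 (k C_) ⌊ w /2⌋)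
    ≡⟨ cong₂ _+_ (sym (C-pascal₂ n w)) (sym (C-pascal k ⌊ w /2⌋)) ⟩
  suc (suc n) C w + suc k C ⌊ w /2⌋ ∎
  where
  n = oddLen k
  E01 = withEnds false true (allVectors n)
  E00 = withEnds false false (reps k)
  E11 = withEnds true true (reps k)
  s₁ = shift 1 (n C_) w
  g : ℕ → ℕ
  g v = n C v + k C ⌊ v /2⌋
  count-01 : count (weight p) w E01 ≡ s₁
  count-01 = trans (count-withEnds k p false true w (allVectors n))
                   (trans (cong (λ i → shift i (λ v → count (weight (not p)) v (allVectors n)) w) (bit-complement p)) (shift-cong 1 (count-allVectors n (not p)) w))
  twice-count-equal-ends : ∀ l → 2 * count (weight p) w (withEnds l l (reps k)) ≡ shift (bit (l xor p) + bit (l xor p)) g w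
  twice-count-equal-ends l =
    trans (cong (2 *_) (count-withEnds k p l l w (reps k)))
          (trans (sym (shift-* i 2 (λ v → count (weight (not p)) v (reps k)) w)) (shift-cong i (reps-count k (not p)) w))
    where i = bit (l xor p) + bit (l xor p)
  distrib : ∀ x y z → 2 * (x + (y + z)) ≡ 2 * x + (2 * y + 2 * z)
  distrib = solve-∀
  regroup : ∀ s x y z t → 2 * s + ((x + y) + (z + t)) ≡ (x + (s + s) + z) + (y + t)
  regroup = solve-∀

-- The vertex counts

hasCard-filter : ∀ {A : Set} {P : A → Set} (P? : Decidable P) {xs} → Unique xs → (∀ x → x ∈ xs) →
  HasCard P (length (filter P? xs))
hasCard-filter P? {xs} unique complete =
  filter P? xs , Unique.filter⁺ P? unique ,
  (λ x → mk⇔ (proj₂ ∘ ∈-filter⁻ P? {xs = xs}) (∈-filter⁺ P? (complete x))) , refl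

hasRevClassCard-filter : ∀ {m} {P : Vec Bool m → Set} (P? : Decidable P) → (∀ {x y} → RevRel x y → P x → P y) →
  ∀ {xs} → AllPairs Unrelated xs → (∀ x → Any (RevRel x) xs) → HasRevClassCard P (length (filter P? xs))
hasRevClassCard-filter P? respects {xs} unrelated covers =
  filter P? xs , All.all-filter P? xs , AllPairs.filter⁺ P? unrelated , cover , refl
  where
  cover : ∀ x → _ → Any (RevRel x) (filter P? xs)
  cover x px with find (covers x)
  ... | y , y∈xs , x~y = lose (∈-filter⁺ P? y∈xs (respects x~y px)) x~y

level? : ∀ k w → Dec (Level k w)
level? k w = (w ≟ k) ⊎-dec (w ≟ suc (suc k))

vertexR*? : ∀ k → Decidable (VertexR* (oddLen (suc k)))
vertexR*? k x = map′ (Equivalence.from (vertexR*⇔level k)) (Equivalence.to (vertexR*⇔level k)) (level? (suc k) (weight false x))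

vertexR*-respects-revRel : ∀ k {x y} → RevRel x y → VertexR* (oddLen (suc k)) x → VertexR* (oddLen (suc k)) y
vertexR*-respects-revRel k {x} {y} x~y =
  Equivalence.from (vertexR*⇔level k) ∘ subst (Level (suc k)) (sym (weight-revRel (suc k) false x~y)) ∘ Equivalence.to (vertexR*⇔level k)

count-vertexR* : ∀ k xs → length (filter (vertexR*? k) xs) ≡ count (weight false) (suc k) xs + count (weight false) (suc (suc (suc k))) xs
count-vertexR* k xs =
  trans (cong length (filter-≐ (vertexR*? k) (λ x → level? (suc k) (weight false x)) (Equivalence.to (vertexR*⇔level k) , Equivalence.from (vertexR*⇔level k)) xs))
        (length-filter-⊎ (λ x → weight false x ≟ suc k) (λ x → weight false x ≟ suc (suc (suc k))) (λ w≡k w≡k+2 → m≢1+n+m (suc k) {1} (trans (sym w≡k) w≡k+2)) xs)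

n/2≡⌊n/2⌋ : ∀ n → n / 2 ≡ ⌊ n /2⌋
n/2≡⌊n/2⌋ zero = refl
n/2≡⌊n/2⌋ (suc zero) = refl
n/2≡⌊n/2⌋ (suc (suc n)) = trans (m/n≡1+[m∸n]/n {suc (suc n)} {2} (s≤s (s≤s z≤n))) (cong suc (n/2≡⌊n/2⌋ n))

vertex-count-formula : ∀ k → let n = oddLen (suc k) in
  (n + 1) C ((n ∸ 1) / 2) ≡ n C suc k + n C suc (suc (suc k))
vertex-count-formula k = begin
  (n + 1) C ((n ∸ 1) / 2)        ≡⟨ cong₂ _C_ (+-comm n 1) (m*n/n≡m (suc k) 2) ⟩
  suc n C suc k                  ≡⟨ sym (nCk+nC[k+1]≡[n+1]C[k+1] n k) ⟩
  n C k + n C suc k              ≡⟨ cong (_+ n C suc k) (trans (nCk≡nC[n∸k] k≤n) (cong (n C_) n∸k)) ⟩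
  n C (3 + k) + n C suc k        ≡⟨ +-comm (n C (3 + k)) (n C suc k) ⟩
  n C suc k + n C (3 + k)        ∎
  where
  n = oddLen (suc k)
  k≤n : k ≤ n
  k≤n = m≤n⇒m≤1+n (m≤n⇒m≤1+n (m≤n⇒m≤1+n (m≤m*n k 2)))
  n∸k : n ∸ k ≡ 3 + k
  n∸k = trans (cong (_∸ k) (n≡[3+k]+k k)) (m+n∸n≡m (3 + k) k)
    where
    n≡[3+k]+k : ∀ k → 3 + k * 2 ≡ (3 + k) + k
    n≡[3+k]+k = solve-∀

class-count-formula : ∀ k → let n = oddLen k in
  ((n + 1) / 2) C ((n + 1) / 4) ≡ k C ⌊ k /2⌋ + k C suc ⌊ k /2⌋
class-count-formula k = begin
  ((n + 1) / 2) C ((n + 1) / 4)             ≡⟨ cong₂ _C_ [n+1]/2 (trans (sym (m/n/o≡m/[n*o] (n + 1) 2 2)) (cong (_/ 2) [n+1]/2)) ⟩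
  suc k C (suc k / 2)                       ≡⟨ cong (suc k C_) (n/2≡⌊n/2⌋ (suc k)) ⟩
  suc k C ⌊ suc k /2⌋                       ≡⟨ nCk≡nC[n∸k] (⌊n/2⌋≤n (suc k)) ⟩
  suc k C (suc k ∸ ⌊ suc k /2⌋)             ≡⟨ cong (suc k C_) ceiling ⟩
  suc k C suc ⌊ k /2⌋                       ≡⟨ sym (nCk+nC[k+1]≡[n+1]C[k+1] k ⌊ k /2⌋) ⟩
  k C ⌊ k /2⌋ + k C suc ⌊ k /2⌋             ∎
  where
  n = oddLen k
  [n+1]/2 : (n + 1) / 2 ≡ suc k
  [n+1]/2 = trans (cong (_/ 2) (n+1≡[1+k]*2 k)) (m*n/n≡m (suc k) 2)
    where
    n+1≡[1+k]*2 : ∀ k → 1 + k * 2 + 1 ≡ (1 + k) * 2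
    n+1≡[1+k]*2 = solve-∀
  ceiling : suc k ∸ ⌊ suc k /2⌋ ≡ ⌈ suc k /2⌉
  ceiling = trans (cong (_∸ ⌊ suc k /2⌋) (sym (⌊n/2⌋+⌈n/2⌉≡n (suc k)))) (m+n∸m≡n ⌊ suc k /2⌋ ⌈ suc k /2⌉)

mainTheorem1 : (m : ℕ) → 3 ≤ m → m % 2 ≡ 1 →
    HasCard (VertexR* m) ((m + 1) C ((m ∸ 1) / 2)) ×
    (Σ ℕ λ N → HasRevClassCard (VertexR* m) N ×
      2 * N ≡ ((m + 1) C ((m ∸ 1) / 2)) + (((m + 1) / 2) C ((m + 1) / 4)))
mainTheorem1 m 3≤m m-odd with m / 2 | trans (m≡m%n+[m/n]*n m 2) (cong (_+ (m / 2) * 2) m-odd)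
mainTheorem1 _ (s≤s ()) _ | zero | refl
... | suc k | refl =
  subst (HasCard (VertexR* m)) vertex-count (hasCard-filter (vertexR*? k) (allVectors-unique m) ∈-allVectors) ,
  N , hasRevClassCard-filter (vertexR*? k) (vertexR*-respects-revRel k) (reps-unrelated K) (reps-cover K) , class-count
  where
  K = suc k
  N = length (filter (vertexR*? k) (reps K))
  vertex-count : length (filter (vertexR*? k) (allVectors m)) ≡ (m + 1) C ((m ∸ 1) / 2)
  vertex-count = begin
    length (filter (vertexR*? k) (allVectors m))  ≡⟨ count-vertexR* k (allVectors m) ⟩
    count (weight false) K (allVectors m) + count (weight false) (2 + K) (allVectors m)
      ≡⟨ cong₂ _+_ (count-allVectors m false K) (count-allVectors m false (2 + K)) ⟩
    m C K + m C (2 + K)                           ≡⟨ sym (vertex-count-formula k) ⟩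
    (m + 1) C ((m ∸ 1) / 2)                       ∎
  class-count : 2 * N ≡ ((m + 1) C ((m ∸ 1) / 2)) + (((m + 1) / 2) C ((m + 1) / 4))
  class-count = begin
    2 * N                                         ≡⟨ cong (2 *_) (count-vertexR* k (reps K)) ⟩
    2 * (count (weight false) K (reps K) + count (weight false) (2 + K) (reps K))
      ≡⟨ *-distribˡ-+ 2 (count (weight false) K (reps K)) _ ⟩
    2 * count (weight false) K (reps K) + 2 * count (weight false) (2 + K) (reps K)
      ≡⟨ cong₂ _+_ (reps-count K false K) (reps-count K false (2 + K)) ⟩
    (m C K + K C ⌊ K /2⌋) + (m C (2 + K) + K C suc ⌊ K /2⌋)
      ≡⟨ interchange (m C K) (K C ⌊ K /2⌋) (m C (2 + K)) (K C suc ⌊ K /2⌋) ⟩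
    (m C K + m C (2 + K)) + (K C ⌊ K /2⌋ + K C suc ⌊ K /2⌋)
      ≡⟨ cong₂ _+_ (sym (vertex-count-formula k)) (sym (class-count-formula K)) ⟩
    ((m + 1) C ((m ∸ 1) / 2)) + (((m + 1) / 2) C ((m + 1) / 4)) ∎
    where
    interchange : ∀ x y z t → (x + y) + (z + t) ≡ (x + z) + (y + t)
    interchange = solve-∀
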